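{- Let $H^\ell$ be a labelled bipartite graph. If (i) $H$ contains a vertex of degree at least $3$, or (ii) $H$ contains four pairwise non-adjacent vertices that are not all of the same colour under $\ell$, then the class of weakly $H^\ell$-free bipartite graphs has unbounded clique-width.
   Context: A labelled bipartite graph $H^\ell=(B^\ell_H,W^\ell_H,E_H)$ is a bipartite graph $H$ with an ordered partition of its vertex set into two (possibly empty) independent sets $B^\ell_H$ (black) and $W^\ell_H$ (white). $H_1^{\ell_1}\subseteq_{li} H_2^{\ell_2}$ means $H_1$ is an induced subgraph of $H_2$ with $B^{\ell_1}_{H_1}\subseteq B^{\ell_2}_{H_2}$ and $W^{\ell_1}_{H_1}\subseteq W^{\ell_2}_{H_2}$ (up to colour-preserving isomorphism). A bipartite graph $G$ is weakly $H^\ell$-free if there exists a bipartition $(B_G,W_G)$ of $G$ into independent sets with $H^\ell\not\subseteq_{li}(B_G,W_G,E_G)$. Clique-width: the minimum number of labels needed to construct a graph using creation of a single labelled vertex, disjoint union, joining all vertices of label $i$ to all of label $j$ ($i\ne j$), and relabelling $i$ to $j$; a class has unbounded clique-width if no constant bounds the clique-width of all its members. -}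

module Defs where

open import Data.Nat using (ℕ; zero; suc; _+_; _≤_)
open import Data.Bool using (Bool; true; false; _∧_; _∨_; if_then_else_)
open import Data.Fin using (Fin; splitAt; _≟_)
open import Data.Sum using (_⊎_; inj₁; inj₂; [_,_])
open import Data.Product using (Σ; _×_; _,_; ∃)
open import Data.List using (List; map; allFin)
open import Data.Nat.ListAction using (sum)
open import Relation.Binary.PropositionalEquality using (_≡_; _≢_)
open import Relation.Nullary using (¬_)
open import Relation.Nullary.Decidable using (⌊_⌋)
open import Function.Definitions using (Injective; Bijective)

record Graph : Set where
  field
    n      : ℕ
    adj    : Fin n → Fin n → Bool
    sym    : ∀ x y → adj x y ≡ adj y x
    irrefl : ∀ x → adj x x ≡ false
open Graph public

-- A 2-colouring (true = black, false = white) is a bipartition into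
-- two (possibly empty) independent sets.
IsBipartition : (G : Graph) → (Fin (n G) → Bool) → Set
IsBipartition G c = ∀ x y → adj G x y ≡ true → c x ≢ c y

Bipartite : Graph → Set
Bipartite G = Σ (Fin (n G) → Bool) (IsBipartition G)

-- Labelled bipartite graph H^ℓ = (B, W, E): a graph with an ordered
-- bipartition given by the colouring col (black = true).
record LBGraph : Set where
  field
    graph  : Graph
    col    : Fin (n graph) → Bool
    proper : IsBipartition graph col
open LBGraph public

_⊆li_ : LBGraph → LBGraph → Set
H₁ ⊆li H₂ =
  Σ (Fin (n (graph H₁)) → Fin (n (graph H₂))) λ f →
    Injective _≡_ _≡_ f
    × (∀ x y → adj (graph H₂) (f x) (f y) ≡ adj (graph H₁) x y)
    × (∀ x → col H₂ (f x) ≡ col H₁ x)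

WeaklyFree : LBGraph → Graph → Set
WeaklyFree H G =
  Σ (Fin (n G) → Bool) λ c → Σ (IsBipartition G c) λ p →
    ¬ (H ⊆li record { graph = G ; col = c ; proper = p })

degree : (G : Graph) → Fin (n G) → ℕ
degree G v = sum (map (λ u → if adj G v u then 1 else 0) (allFin (n G)))

HasVertexDeg≥3 : LBGraph → Set
HasVertexDeg≥3 H = Σ (Fin (n (graph H))) λ v → 3 ≤ degree (graph H) v

HasMixedIndep4 : LBGraph → Set
HasMixedIndep4 H =
  Σ (Fin 4 → Fin (n (graph H))) λ v →
    Injective _≡_ _≡_ v
    × (∀ i j → i ≢ j → adj (graph H) (v i) (v j) ≡ false)
    × Σ (Fin 4) λ i → Σ (Fin 4) λ j → col H (v i) ≢ col H (v j)

-- Clique-width expressions with labels from Fin k.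
-- 'empty' builds the empty graph (convention so that the null graph has
-- clique-width bounded by any k).
data CWExpr (k : ℕ) : Set where
  empty   : CWExpr k
  vertex  : Fin k → CWExpr k
  union   : CWExpr k → CWExpr k → CWExpr k
  join    : (i j : Fin k) → i ≢ j → CWExpr k → CWExpr k
  relabel : (i j : Fin k) → CWExpr k → CWExpr k

size : ∀ {k} → CWExpr k → ℕ
size empty           = 0
size (vertex _)      = 1
size (union e₁ e₂)   = size e₁ + size e₂
size (join _ _ _ e)  = size e
size (relabel _ _ e) = size e

labelE : ∀ {k} (e : CWExpr k) → Fin (size e) → Fin k
labelE empty           ()
labelE (vertex i)      _ = i
labelE (union e₁ e₂)   x = [ labelE e₁ , labelE e₂ ] (splitAt (size e₁) x)
labelE (join _ _ _ e)  x = labelE e x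
labelE (relabel i j e) x = if ⌊ labelE e x ≟ i ⌋ then j else labelE e x

adjE : ∀ {k} (e : CWExpr k) → Fin (size e) → Fin (size e) → Bool
adjE empty           () _
adjE (vertex _)      _ _ = false
adjE (union e₁ e₂)   x y with splitAt (size e₁) x | splitAt (size e₁) y
... | inj₁ a | inj₁ b = adjE e₁ a b
... | inj₂ a | inj₂ b = adjE e₂ a b
... | inj₁ _ | inj₂ _ = false
... | inj₂ _ | inj₁ _ = false
adjE (join i j _ e)  x y =
  adjE e x y
  ∨ (⌊ labelE e x ≟ i ⌋ ∧ ⌊ labelE e y ≟ j ⌋)
  ∨ (⌊ labelE e x ≟ j ⌋ ∧ ⌊ labelE e y ≟ i ⌋)
adjE (relabel _ _ e) x y = adjE e x y

CWAtMost : ℕ → Graph → Set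
CWAtMost k G =
  Σ (CWExpr k) λ e → Σ (Fin (size e) → Fin (n G)) λ f →
    Bijective _≡_ _≡_ f × (∀ x y → adj G (f x) (f y) ≡ adjE e x y)

UnboundedCW : (Graph → Set) → Set
UnboundedCW C = ¬ (Σ ℕ λ k → ∀ G → C G → CWAtMost k G)

WeaklyFreeBipartite : LBGraph → Graph → Set
WeaklyFreeBipartite H G = Bipartite G × WeaklyFree H G

module Submission where

-- Two families of bipartite graphs on vertices A i, B j and C i j (i, j < m)
-- are used: for b = false the middle vertex C i j is adjacent to A i and B j
-- (the 1-subdivision of K_{m,m}), for b = true to all the other A's and B's.
--
-- A graph of clique-width at most k has, for every vertex set P
-- and 1 ≤ T ≤ |P|, a vertex set S meeting P in between T and 2T vertices that
-- k labels split into modules towards the rest of the graph (the vertex set of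
-- a suitable subexpression).  For P the side vertices of the graphs with
-- m = 3L and L = 2(k + 1), such an S contains L vertices of one side and misses
-- L of the other; matching them up through middle vertices gives k + 1
-- vertices of S pairwise told apart from outside S, more than k labels allow.
--
-- Colour the middle vertices like a vertex of degree at least 3
-- (b = false), or with the rarer colour among four independent vertices of
-- both colours (b = true); then H^ℓ has no colour-preserving induced copy.

open import Defs hiding (sym)
open import Data.Nat using (ℕ; zero; suc; _+_; _*_; _≤_; _<_; z≤n; s≤s; _≤?_)
open import Data.Nat.Properties
  using ( ≤-refl; ≤-reflexive; ≤-trans; ≤-pred; n≤1+n; m≤m+n; m≤n+m; n<1+n; <⇒≤; <⇒≱; ≰⇒>
        ; 1+n≰n; <-irrefl; +-assoc; +-suc; +-comm; +-identityʳ; +-mono-<; +-mono-≤-<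
        ; +-0-commutativeMonoid )
open import Data.Bool using (Bool; true; false; not; _∧_; _∨_; _xor_; if_then_else_)
open import Data.Bool.Properties using (∧-identityʳ; ∧-zeroʳ; not-injective; not-¬)
open import Data.Fin using (Fin; zero; suc; _↑ˡ_; _↑ʳ_; splitAt; _≟_)
open import Data.Fin.Patterns using (0F; 1F; 2F)
open import Data.Fin.Properties
  using (suc-injective; splitAt-↑ˡ; splitAt-↑ʳ; +↔⊎; *↔×; pigeonhole; <⇒≢)
open import Data.Fin.Permutation using (Permutation; _⟨$⟩ʳ_; _⟨$⟩ˡ_; inverseˡ; inverseʳ)
open import Data.Product using (Σ; _×_; _,_; proj₁; proj₂)
open import Data.Sum using (_⊎_; inj₁; inj₂; [_,_])
open import Data.Sum.Function.Propositional using (_⊎-↔_)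
open import Data.Empty using (⊥; ⊥-elim)
open import Data.List using (tabulate)
open import Data.List.Properties using (map-tabulate)
open import Data.Nat.ListAction using (sum)
open import Relation.Nullary using (¬_; yes; no)
open import Relation.Nullary.Decidable using (⌊_⌋)
open import Function using (_∘_; id)
open import Function.Bundles using (_↔_; Inverse; mk⤖)
open import Function.Definitions using (Injective)
open import Function.Properties.Bijection using (⤖⇒↔)
open import Function.Properties.Inverse using (↔-trans)
open import Relation.Binary.PropositionalEquality hiding ([_])
import Algebra.Properties.CommutativeMonoid.Sum as MonoidSum

module ℕ-Sum = MonoidSum +-0-commutativeMonoid

indicator : Bool → ℕ
indicator b = if b then 1 else 0

count : ∀ {n} → (Fin n → Bool) → ℕ
count {zero}  h = 0
count {suc n} h = indicator (h zero) + count (h ∘ suc)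

count-cong : ∀ {n} {h h′ : Fin n → Bool} → (∀ x → h x ≡ h′ x) → count h ≡ count h′
count-cong {zero}  eq = refl
count-cong {suc n} eq = cong₂ _+_ (cong indicator (eq zero)) (count-cong (eq ∘ suc))

count-sum : ∀ {n} (h : Fin n → Bool) → count h ≡ ℕ-Sum.sum (indicator ∘ h)
count-sum {zero}  h = refl
count-sum {suc n} h = cong (indicator (h zero) +_) (count-sum (h ∘ suc))

count-false : ∀ n → count {n} (λ _ → false) ≡ 0
count-false zero    = refl
count-false (suc n) = count-false n

count-true : ∀ n → count {n} (λ _ → true) ≡ n
count-true zero    = refl
count-true (suc n) = cong suc (count-true n)

count-≤ : ∀ {n} (h : Fin n → Bool) → count h ≤ n
count-≤ {zero}  h = z≤n
count-≤ {suc n} h with h zero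
... | true  = s≤s (count-≤ (h ∘ suc))
... | false = ≤-trans (count-≤ (h ∘ suc)) (n≤1+n n)

count-++ : ∀ m n (h : Fin (m + n) → Bool) →
  count h ≡ count (h ∘ (_↑ˡ n)) + count (h ∘ (m ↑ʳ_))
count-++ zero    n h = refl
count-++ (suc m) n h =
  trans (cong (indicator (h zero) +_) (count-++ m n (h ∘ suc)))
        (sym (+-assoc (indicator (h zero)) _ _))

count-complement : ∀ {n} (h : Fin n → Bool) → count h + count (not ∘ h) ≡ n
count-complement {zero}  h = refl
count-complement {suc n} h with h zero
... | true  = cong suc (count-complement (h ∘ suc))
... | false = trans (+-suc (count (h ∘ suc)) _) (cong suc (count-complement (h ∘ suc)))

count-permute : ∀ {a b} (π : Permutation a b) (h : Fin b → Bool) →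
  count (h ∘ (π ⟨$⟩ʳ_)) ≡ count h
count-permute π h = begin
  count (h ∘ (π ⟨$⟩ʳ_))                 ≡⟨ count-sum (h ∘ (π ⟨$⟩ʳ_)) ⟩
  ℕ-Sum.sum (indicator ∘ h ∘ (π ⟨$⟩ʳ_)) ≡⟨ ℕ-Sum.sum-permute (indicator ∘ h) π ⟨
  ℕ-Sum.sum (indicator ∘ h)             ≡⟨ count-sum h ⟨
  count h                               ∎
  where open ≡-Reasoning

count-positive : ∀ {n} (h : Fin n → Bool) x → h x ≡ true → 1 ≤ count h
count-positive h zero    hx rewrite hx = s≤s z≤n
count-positive h (suc x) hx = ≤-trans (count-positive (h ∘ suc) x hx) (m≤n+m _ _)

select : ∀ {n} (h : Fin n → Bool) r → r ≤ count h →
  Σ (Fin r → Fin n) λ g → Injective _≡_ _≡_ g × (∀ u → h (g u) ≡ true)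
select         h zero    _  = (λ ()) , (λ { {()} }) , λ ()
select {zero}  h (suc r) ()
select {suc n} h (suc r) r≤ with h zero in h0
... | true  = let (g , g-inj , g-sat) = select (h ∘ suc) r (≤-pred r≤) in
  cons g , cons-injective g-inj , cons-sat g-sat
  where
  cons : (Fin r → Fin n) → Fin (suc r) → Fin (suc n)
  cons g zero    = zero
  cons g (suc u) = suc (g u)
  cons-injective : ∀ {g} → Injective _≡_ _≡_ g → Injective _≡_ _≡_ (cons g)
  cons-injective g-inj {zero}  {zero}  _  = refl
  cons-injective g-inj {suc u} {suc v} eq = cong suc (g-inj (suc-injective eq))
  cons-sat : ∀ {g} → (∀ u → h (suc (g u)) ≡ true) → ∀ u → h (cons g u) ≡ true
  cons-sat g-sat zero    = h0
  cons-sat g-sat (suc u) = g-sat u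
... | false = let (g , g-inj , g-sat) = select (h ∘ suc) (suc r) r≤ in
  suc ∘ g , g-inj ∘ suc-injective , g-sat

degree-count : (G : Graph) (v : Fin (n G)) → degree G v ≡ count (adj G v)
degree-count G v = trans (cong sum (map-tabulate id (indicator ∘ adj G v))) (sum-tabulate (adj G v))
  where
  sum-tabulate : ∀ {m} (h : Fin m → Bool) → sum (tabulate (indicator ∘ h)) ≡ count h
  sum-tabulate {zero}  h = refl
  sum-tabulate {suc m} h = cong (indicator (h zero) +_) (sum-tabulate (h ∘ suc))

both-values : ∀ {n} (h : Fin n → Bool) i j → h i ≢ h j → 1 ≤ count h × 1 ≤ count (not ∘ h)
both-values h i j hi≢hj with h i in hi | h j in hj
... | true  | true  = ⊥-elim (hi≢hj refl)
... | true  | false = count-positive h i hi , count-positive (not ∘ h) j (cong not hj)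
... | false | true  = count-positive h j hj , count-positive (not ∘ h) i (cong not hi)
... | false | false = ⊥-elim (hi≢hj refl)

_∩_ : ∀ {X : Set} → (X → Bool) → (X → Bool) → X → Bool
(P ∩ S) x = P x ∧ S x

ModularBy : ∀ {X : Set} {k} → (X → X → Bool) → (X → Bool) → (X → Fin k) → Set
ModularBy adj S lab = ∀ x y z → S x ≡ true → S y ≡ true → S z ≡ false →
  lab x ≡ lab y → adj x z ≡ adj y z

modular-pullback : ∀ {X Y : Set} {k} {adj : X → X → Bool} {adj′ : Y → Y → Bool}
  {S : X → Bool} {lab : X → Fin k} (g : Y → X) → (∀ u w → adj′ u w ≡ adj (g u) (g w)) →
  ModularBy adj S lab → ModularBy adj′ (S ∘ g) (lab ∘ g)
modular-pullback g adj-g mod x y z sx sy sz eq =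
  trans (adj-g x z) (trans (mod (g x) (g y) (g z) sx sy sz eq) (sym (adj-g y z)))

Between : ℕ → ℕ → Set
Between T c = T ≤ c × c ≤ T + T

Balanced : ∀ {n} → (P S : Fin n → Bool) → ℕ → Set
Balanced P S T = Between T (count (P ∩ S))

-- The vertex
-- set of any subexpression is homogeneous, labelled by the labels it has there.
record Homogeneous {k} (e : CWExpr k) (S : Fin (size e) → Bool) : Set where
  field
    lab       : Fin (size e) → Fin k
    sameLabel : ∀ x y → S x ≡ true → S y ≡ true → lab x ≡ lab y → labelE e x ≡ labelE e y
    modular   : ModularBy (adjE e) S lab
open Homogeneous

whole-homogeneous : ∀ {k} (e : CWExpr k) → Homogeneous e (λ _ → true)
whole-homogeneous e = record
  { lab = labelE e ; sameLabel = λ _ _ _ _ eq → eq ; modular = λ { _ _ _ _ _ () } }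

empty-homogeneous : ∀ {k} (e : CWExpr k) → Homogeneous e (λ _ → false)
empty-homogeneous e = record
  { lab = labelE e ; sameLabel = λ { _ _ () } ; modular = λ { _ _ _ () } }

-- Joining and relabelling act on labels, so they preserve homogeneity.
join-homogeneous : ∀ {k} i j (i≢j : i ≢ j) (e : CWExpr k) {S} →
  Homogeneous e S → Homogeneous (join i j i≢j e) S
join-homogeneous i j i≢j e h = record
  { lab = lab h ; sameLabel = sameLabel h ; modular = modular′ }
  where
  modular′ : ModularBy (adjE (join i j i≢j e)) _ (lab h)
  modular′ x y z sx sy sz eq =
    cong₂ (λ a l → a ∨ (⌊ l ≟ i ⌋ ∧ ⌊ labelE e z ≟ j ⌋) ∨ (⌊ l ≟ j ⌋ ∧ ⌊ labelE e z ≟ i ⌋))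
      (modular h x y z sx sy sz eq) (sameLabel h x y sx sy eq)

relabel-homogeneous : ∀ {k} i j (e : CWExpr k) {S} →
  Homogeneous e S → Homogeneous (relabel i j e) S
relabel-homogeneous i j e h = record
  { lab = lab h
  ; sameLabel = λ x y sx sy eq → cong (λ l → if ⌊ l ≟ i ⌋ then j else l) (sameLabel h x y sx sy eq)
  ; modular = modular h }

-- Side by side in a disjoint union, homogeneous sets stay homogeneous provided
-- at most one of them is non-empty (otherwise their labellings would clash).
union-homogeneous : ∀ {k} (e₁ e₂ : CWExpr k) {S₁ S₂} → Homogeneous e₁ S₁ → Homogeneous e₂ S₂ →
  (∀ a b → S₁ a ≡ true → S₂ b ≡ true → ⊥) →
  Homogeneous (union e₁ e₂) (λ x → [ S₁ , S₂ ] (splitAt (size e₁) x))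
union-homogeneous e₁ e₂ {S₁} {S₂} h₁ h₂ disjoint = record
  { lab = λ x → [ lab h₁ , lab h₂ ] (splitAt (size e₁) x)
  ; sameLabel = λ x y → sameLabel′ (splitAt (size e₁) x) (splitAt (size e₁) y)
  ; modular = modular′ }
  where
  sameLabel′ : ∀ u v → [ S₁ , S₂ ] u ≡ true → [ S₁ , S₂ ] v ≡ true →
    [ lab h₁ , lab h₂ ] u ≡ [ lab h₁ , lab h₂ ] v →
    [ labelE e₁ , labelE e₂ ] u ≡ [ labelE e₁ , labelE e₂ ] v
  sameLabel′ (inj₁ a) (inj₁ b) sa sb = sameLabel h₁ a b sa sb
  sameLabel′ (inj₂ a) (inj₂ b) sa sb = sameLabel h₂ a b sa sb
  sameLabel′ (inj₁ a) (inj₂ b) sa sb = ⊥-elim (disjoint a b sa sb)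
  sameLabel′ (inj₂ a) (inj₁ b) sa sb = ⊥-elim (disjoint b a sb sa)
  modular′ : ModularBy (adjE (union e₁ e₂)) (λ x → [ S₁ , S₂ ] (splitAt (size e₁) x))
                                            (λ x → [ lab h₁ , lab h₂ ] (splitAt (size e₁) x))
  modular′ x y z sx sy sz eq
    with splitAt (size e₁) x | splitAt (size e₁) y | splitAt (size e₁) z
  ... | inj₁ a | inj₁ b | inj₁ c = modular h₁ a b c sx sy sz eq
  ... | inj₂ a | inj₂ b | inj₂ c = modular h₂ a b c sx sy sz eq
  ... | inj₁ a | inj₁ b | inj₂ c = refl
  ... | inj₂ a | inj₂ b | inj₁ c = refl
  ... | inj₁ a | inj₂ b | _      = ⊥-elim (disjoint a b sx sy)
  ... | inj₂ a | inj₁ b | _      = ⊥-elim (disjoint b a sy sx)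

count-∩-true : ∀ {n} (P : Fin n → Bool) → count (P ∩ (λ _ → true)) ≡ count P
count-∩-true P = count-cong (λ x → ∧-identityʳ (P x))

count-∩-false : ∀ {n} (P : Fin n → Bool) → count (P ∩ (λ _ → false)) ≡ 0
count-∩-false {n} P = trans (count-cong (λ x → ∧-zeroʳ (P x))) (count-false n)

count-∩-blocks : ∀ n₁ n₂ (P : Fin (n₁ + n₂) → Bool) (S₁ : Fin n₁ → Bool) (S₂ : Fin n₂ → Bool) →
  count (P ∩ (λ x → [ S₁ , S₂ ] (splitAt n₁ x)))
    ≡ count ((P ∘ (_↑ˡ n₂)) ∩ S₁) + count ((P ∘ (n₁ ↑ʳ_)) ∩ S₂)
count-∩-blocks n₁ n₂ P S₁ S₂ = trans (count-++ n₁ n₂ _) (cong₂ _+_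
  (count-cong (λ a → cong (λ u → P (a ↑ˡ n₂) ∧ [ S₁ , S₂ ] u) (splitAt-↑ˡ n₁ a n₂)))
  (count-cong (λ b → cong (λ u → P (n₁ ↑ʳ b) ∧ [ S₁ , S₂ ] u) (splitAt-↑ʳ n₁ n₂ b))))

count-∩-left : ∀ n₁ n₂ (P : Fin (n₁ + n₂) → Bool) (S₁ : Fin n₁ → Bool) →
  count (P ∩ (λ x → [ S₁ , (λ _ → false) ] (splitAt n₁ x))) ≡ count ((P ∘ (_↑ˡ n₂)) ∩ S₁)
count-∩-left n₁ n₂ P S₁ = begin
  count (P ∩ (λ x → [ S₁ , (λ _ → false) ] (splitAt n₁ x)))
    ≡⟨ count-∩-blocks n₁ n₂ P S₁ (λ _ → false) ⟩
  count ((P ∘ (_↑ˡ n₂)) ∩ S₁) + count ((P ∘ (n₁ ↑ʳ_)) ∩ (λ _ → false))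
    ≡⟨ cong (count ((P ∘ (_↑ˡ n₂)) ∩ S₁) +_) (count-∩-false (P ∘ (n₁ ↑ʳ_))) ⟩
  count ((P ∘ (_↑ˡ n₂)) ∩ S₁) + 0
    ≡⟨ +-identityʳ _ ⟩
  count ((P ∘ (_↑ˡ n₂)) ∩ S₁) ∎
  where open ≡-Reasoning

count-∩-right : ∀ n₁ n₂ (P : Fin (n₁ + n₂) → Bool) (S₂ : Fin n₂ → Bool) →
  count (P ∩ (λ x → [ (λ _ → false) , S₂ ] (splitAt n₁ x))) ≡ count ((P ∘ (n₁ ↑ʳ_)) ∩ S₂)
count-∩-right n₁ n₂ P S₂ =
  trans (count-∩-blocks n₁ n₂ P (λ _ → false) S₂)
        (cong (_+ count ((P ∘ (n₁ ↑ʳ_)) ∩ S₂)) (count-∩-false (P ∘ (_↑ˡ n₂))))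

between-≡ : ∀ {T c c′} → c ≡ c′ → Between T c′ → Between T c
between-≡ refl bounds = bounds

whole-balanced : ∀ {k} (e : CWExpr k) P T → T ≤ count P → count P ≤ T + T →
  Σ (Fin (size e) → Bool) λ S → Homogeneous e S × Balanced P S T
whole-balanced e P T lo hi = _ , whole-homogeneous e , between-≡ (count-∩-true P) (lo , hi)

-- Descend into the union operand holding at least T vertices of P; if neither
-- does, the whole union has fewer than 2T of them and is the required set.
balanced-homogeneous : ∀ {k} (e : CWExpr k) (P : Fin (size e) → Bool) T → 1 ≤ T → T ≤ count P →
  Σ (Fin (size e) → Bool) λ S → Homogeneous e S × Balanced P S T
balanced-homogeneous empty P T 1≤T T≤0 = ⊥-elim (1+n≰n (≤-trans 1≤T T≤0))
balanced-homogeneous (vertex i) P T 1≤T T≤P =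
  whole-balanced (vertex i) P T T≤P (≤-trans (count-≤ P) (≤-trans 1≤T (m≤m+n T T)))
balanced-homogeneous (join i j i≢j e) P T 1≤T T≤P =
  let (S , h , bal) = balanced-homogeneous e P T 1≤T T≤P in
  S , join-homogeneous i j i≢j e h , bal
balanced-homogeneous (relabel i j e) P T 1≤T T≤P =
  let (S , h , bal) = balanced-homogeneous e P T 1≤T T≤P in
  S , relabel-homogeneous i j e h , bal
balanced-homogeneous (union e₁ e₂) P T 1≤T T≤P
  with T ≤? count (P ∘ (_↑ˡ size e₂)) | T ≤? count (P ∘ (size e₁ ↑ʳ_))
... | yes T≤P₁ | _ =
  let (S₁ , h₁ , bal₁) = balanced-homogeneous e₁ _ T 1≤T T≤P₁ in
  _ , union-homogeneous e₁ e₂ h₁ (empty-homogeneous e₂) (λ _ _ _ ()) ,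
  between-≡ (count-∩-left (size e₁) (size e₂) P S₁) bal₁
... | no _ | yes T≤P₂ =
  let (S₂ , h₂ , bal₂) = balanced-homogeneous e₂ _ T 1≤T T≤P₂ in
  _ , union-homogeneous e₁ e₂ (empty-homogeneous e₁) h₂ (λ _ _ ()) ,
  between-≡ (count-∩-right (size e₁) (size e₂) P S₂) bal₂
... | no T≰P₁ | no T≰P₂ =
  whole-balanced (union e₁ e₂) P T T≤P (subst (_≤ T + T) (sym (count-++ (size e₁) (size e₂) P))
                                      (<⇒≤ (+-mono-< (≰⇒> T≰P₁) (≰⇒> T≰P₂))))

BalancedCut : ℕ → (G : Graph) → (Fin (n G) → Bool) → ℕ → Set
BalancedCut k G P T = Σ (Fin (n G) → Bool) λ S → Σ (Fin (n G) → Fin k) λ lab →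
  ModularBy (adj G) S lab × Balanced P S T

transport-cut : ∀ {k} (G : Graph) (e : CWExpr k) (π : Permutation (size e) (n G)) →
  (∀ x y → adj G (π ⟨$⟩ʳ x) (π ⟨$⟩ʳ y) ≡ adjE e x y) → (P : Fin (n G) → Bool) (T : ℕ) →
  Σ (Fin (size e) → Bool) (λ S → Homogeneous e S × Balanced (P ∘ (π ⟨$⟩ʳ_)) S T) →
  BalancedCut k G P T
transport-cut G e π adj-π P T (S , h , bal) =
  S ∘ π⁻¹ , lab h ∘ π⁻¹ , modular-pullback π⁻¹ adj-π⁻¹ (modular h) , between-≡ count-eq bal
  where
  π⁻¹ : Fin (n G) → Fin (size e)
  π⁻¹ = π ⟨$⟩ˡ_
  adj-π⁻¹ : ∀ u w → adj G u w ≡ adjE e (π⁻¹ u) (π⁻¹ w)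
  adj-π⁻¹ u w = trans (sym (cong₂ (adj G) (inverseʳ π) (inverseʳ π))) (adj-π (π⁻¹ u) (π⁻¹ w))
  count-eq : count (P ∩ (S ∘ π⁻¹)) ≡ count ((P ∘ (π ⟨$⟩ʳ_)) ∩ S)
  count-eq = trans (sym (count-permute π (P ∩ (S ∘ π⁻¹))))
                   (count-cong (λ x → cong (λ y → P (π ⟨$⟩ʳ x) ∧ S y) (inverseˡ π)))

balanced-cut : ∀ {k} (G : Graph) → CWAtMost k G → (P : Fin (n G) → Bool) (T : ℕ) →
  1 ≤ T → T ≤ count P → BalancedCut k G P T
balanced-cut G (e , f , f-bij , adj-f) P T 1≤T T≤P =
  transport-cut G e π adj-f P T
    (balanced-homogeneous e (P ∘ f) T 1≤T (subst (T ≤_) (sym (count-permute π P)) T≤P))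
  where
  π : Permutation (size e) (n G)
  π = ⤖⇒↔ (mk⤖ f-bij)

Vtx : ℕ → Set
Vtx m = (Fin m ⊎ Fin m) ⊎ (Fin m × Fin m)

pattern A i   = inj₁ (inj₁ i)
pattern B j   = inj₁ (inj₂ j)
pattern C i j = inj₂ (i , j)

order : ℕ → ℕ
order m = (m + m) + m * m

enumerate : ∀ m → Fin (order m) ↔ Vtx m
enumerate m = ↔-trans (+↔⊎ {m + m}) (+↔⊎ {m} ⊎-↔ *↔× {m} {m})

decode : ∀ m → Fin (order m) → Vtx m
decode m = Inverse.to (enumerate m)

encode : ∀ m → Vtx m → Fin (order m)
encode m = Inverse.from (enumerate m)

decode-encode : ∀ m (u : Vtx m) → decode m (encode m u) ≡ u
decode-encode m = Inverse.strictlyInverseˡ (enumerate m)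

decode-injective : ∀ m {x y : Fin (order m)} → decode m x ≡ decode m y → x ≡ y
decode-injective m {x} {y} eq = begin
  x                     ≡⟨ Inverse.strictlyInverseʳ (enumerate m) x ⟨
  encode m (decode m x) ≡⟨ cong (encode m) eq ⟩
  encode m (decode m y) ≡⟨ Inverse.strictlyInverseʳ (enumerate m) y ⟩
  y                     ∎
  where open ≡-Reasoning

-- For b = false the middle vertex C i j is adjacent to exactly A i and B j
-- (the 1-subdivision of K_{m,m}); for b = true to exactly the other A's and B's.
adjV : ∀ {m} → Bool → Vtx m → Vtx m → Bool
adjV b (A i)    (C i′ j) = b xor ⌊ i ≟ i′ ⌋
adjV b (C i′ j) (A i)    = b xor ⌊ i ≟ i′ ⌋
adjV b (B j)    (C i j′) = b xor ⌊ j ≟ j′ ⌋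
adjV b (C i j′) (B j)    = b xor ⌊ j ≟ j′ ⌋
adjV b _        _        = false

adjV-sym : ∀ {m} b (u w : Vtx m) → adjV b u w ≡ adjV b w u
adjV-sym b (A _)   (A _)   = refl
adjV-sym b (A _)   (B _)   = refl
adjV-sym b (A _)   (C _ _) = refl
adjV-sym b (B _)   (A _)   = refl
adjV-sym b (B _)   (B _)   = refl
adjV-sym b (B _)   (C _ _) = refl
adjV-sym b (C _ _) (A _)   = refl
adjV-sym b (C _ _) (B _)   = refl
adjV-sym b (C _ _) (C _ _) = refl

adjV-irrefl : ∀ {m} b (u : Vtx m) → adjV b u u ≡ false
adjV-irrefl b (A _)   = refl
adjV-irrefl b (B _)   = refl
adjV-irrefl b (C _ _) = refl

family : Bool → ℕ → Graph
family b m = record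
  { n      = order m
  ; adj    = λ x y → adjV b (decode m x) (decode m y)
  ; sym    = λ x y → adjV-sym b (decode m x) (decode m y)
  ; irrefl = λ x → adjV-irrefl b (decode m x) }

colV : ∀ {m} → Bool → Vtx m → Bool
colV β (C _ _) = β
colV β _       = not β

colV-proper : ∀ {m} b β (u w : Vtx m) → adjV b u w ≡ true → colV β u ≢ colV β w
colV-proper b false (A _)   (C _ _) _ ()
colV-proper b true  (A _)   (C _ _) _ ()
colV-proper b false (B _)   (C _ _) _ ()
colV-proper b true  (B _)   (C _ _) _ ()
colV-proper b false (C _ _) (A _)   _ ()
colV-proper b true  (C _ _) (A _)   _ ()
colV-proper b false (C _ _) (B _)   _ ()
colV-proper b true  (C _ _) (B _)   _ ()

isSide : ∀ {m} → Vtx m → Bool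
isSide (C _ _) = false
isSide _       = true

decode-middle : ∀ m (c : Fin (m * m)) → isSide (decode m ((m + m) ↑ʳ c)) ≡ false
decode-middle m c = cong isSide (begin
  decode m ((m + m) ↑ʳ c)                          ≡⟨ cong (decode m ∘ ((m + m) ↑ʳ_)) (Inverse.strictlyInverseʳ (*↔× {m} {m}) c) ⟨
  decode m (encode m (inj₂ (Inverse.to *↔× c)))    ≡⟨ decode-encode m _ ⟩
  inj₂ (Inverse.to *↔× c)                          ∎)
  where open ≡-Reasoning

count-sides : ∀ m (S : Fin (order m) → Bool) →
  count ((isSide ∘ decode m) ∩ S) ≡ count (S ∘ encode m ∘ A) + count (S ∘ encode m ∘ B)
count-sides m S = begin
  count side∩S
    ≡⟨ count-++ (m + m) (m * m) side∩S ⟩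
  count (side∩S ∘ (_↑ˡ m * m)) + count (side∩S ∘ ((m + m) ↑ʳ_))
    ≡⟨ cong₂ _+_ (count-++ m m (side∩S ∘ (_↑ˡ m * m))) middle-none ⟩
  (count (side∩S ∘ encode m ∘ A) + count (side∩S ∘ encode m ∘ B)) + 0
    ≡⟨ +-identityʳ _ ⟩
  count (side∩S ∘ encode m ∘ A) + count (side∩S ∘ encode m ∘ B)
    ≡⟨ cong₂ _+_ (count-cong (λ i → on-side (A i) refl)) (count-cong (λ j → on-side (B j) refl)) ⟩
  count (S ∘ encode m ∘ A) + count (S ∘ encode m ∘ B) ∎
  where
  open ≡-Reasoning
  side∩S = (isSide ∘ decode m) ∩ S
  on-side : ∀ u → isSide u ≡ true → side∩S (encode m u) ≡ S (encode m u)
  on-side u side = cong (_∧ S (encode m u)) (trans (cong isSide (decode-encode m u)) side)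
  middle-none : count (side∩S ∘ ((m + m) ↑ʳ_)) ≡ 0
  middle-none = trans (count-cong (λ c → cong (_∧ S ((m + m) ↑ʳ c)) (decode-middle m c))) (count-false (m * m))

at-least-half : ∀ K a b → K + K ≤ a + b → K ≤ a ⊎ K ≤ b
at-least-half K a b 2K≤a+b with K ≤? a | K ≤? b
... | yes K≤a | _       = inj₁ K≤a
... | no _    | yes K≤b = inj₂ K≤b
... | no K≰a  | no K≰b  = ⊥-elim (<⇒≱ (+-mono-< (≰⇒> K≰a) (≰⇒> K≰b)) 2K≤a+b)

complement-large : ∀ L x y → x + y ≡ L + L + L → y < L → L + L < x
complement-large L x y total y<L = ≰⇒> (λ x≤2L → <-irrefl total (+-mono-≤-< x≤2L y<L))

side-split : ∀ L a a′ b b′ → a + a′ ≡ L + L + L → b + b′ ≡ L + L + L →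
  Between (L + L) (a + b) → (L ≤ a × L ≤ b′) ⊎ (L ≤ b × L ≤ a′)
side-split L a a′ b b′ a-total b-total (lo , hi) with L ≤? a | L ≤? b′
... | yes L≤a | yes L≤b′ = inj₁ (L≤a , L≤b′)
... | no L≰a  | _        = inj₂ (L≤b , L≤a′)
  where
  L≤b : L ≤ b
  L≤b = [ (λ L≤a → ⊥-elim (L≰a L≤a)) , (λ L≤b → L≤b) ] (at-least-half L a b lo)
  L≤a′ : L ≤ a′
  L≤a′ = ≤-trans (m≤m+n L L)
    (<⇒≤ (complement-large L a′ a (trans (+-comm a′ a) a-total) (≰⇒> L≰a)))
... | yes L≤a | no L≰b′ = inj₂ (≤-trans (m≤m+n L L) (<⇒≤ 2L<b) , L≤a′)
  where
  2L<b : L + L < b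
  2L<b = complement-large L b b′ b-total (≰⇒> L≰b′)
  L≤a′ : L ≤ a′
  L≤a′ with L ≤? a′
  ... | yes L≤a′ = L≤a′
  ... | no L≰a′  = ⊥-elim (<⇒≱ (+-mono-< (complement-large L a a′ a-total (≰⇒> L≰a′)) 2L<b) hi)

distinguished-bound : ∀ {X : Set} {k} {adj : X → X → Bool} {S : X → Bool} {lab : X → Fin k} →
  ModularBy adj S lab → (x y : Fin (suc k) → X) →
  (∀ u → S (x u) ≡ true) → (∀ u → S (y u) ≡ false) →
  (∀ u v → u ≢ v → adj (x u) (y u) ≢ adj (x v) (y u)) → ⊥
distinguished-bound {k = k} {lab = lab} modular x y x∈S y∉S distinguished
  with u , v , u<v , same-label ← pigeonhole (n<1+n k) (lab ∘ x)
  = distinguished u v (<⇒≢ u<v) (modular (x u) (x v) (y u) (x∈S u) (x∈S v) (y∉S u) same-label)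

xor-differs : ∀ b {m} {i j i′ j′ : Fin m} → i ≡ j → i′ ≢ j′ →
  b xor ⌊ i ≟ j ⌋ ≢ b xor ⌊ i′ ≟ j′ ⌋
xor-differs b {i = i} {j} {i′} {j′} i≡j i′≢j′ with i ≟ j | i′ ≟ j′
... | no i≢j | _        = ⊥-elim (i≢j i≡j)
... | _      | yes i′≡j′ = ⊥-elim (i′≢j′ i′≡j′)
xor-differs true  _ _ | yes _ | no _ = λ ()
xor-differs false _ _ | yes _ | no _ = λ ()

-- The graphs witnessing unboundedness for k labels: L k pairs are matched up
-- in the lower bound, and each side has M k = 3 L k vertices.
L : ℕ → ℕ
L k = suc k + suc k

M : ℕ → ℕ
M k = L k + L k + L k

-- Match them up in pairs (a u , c u) through
-- the middle vertices C (a u) (c u); k + 1 of these lie in S or k + 1 lie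
-- outside S.  In the first case they are told apart by their B-neighbours,
-- in the second case the corresponding A-vertices are told apart by them.
A-in-B-out-impossible : ∀ k b {m} {S : Vtx m → Bool} {lab : Vtx m → Fin k} →
  ModularBy (adjV b) S lab → L k ≤ count (S ∘ A) → L k ≤ count (not ∘ S ∘ B) → ⊥
A-in-B-out-impossible k b {S = S} modular many-A-in many-B-out
  with a , a-inj , a∈S ← select (S ∘ A) (L k) many-A-in
     | c , c-inj , c∉S ← select (not ∘ S ∘ B) (L k) many-B-out
  = [ middle-in , middle-out ]
      (at-least-half (suc k) (count R) (count (not ∘ R)) (≤-reflexive (sym (count-complement R))))
  where
  R : Fin (L k) → Bool
  R u = S (C (a u) (c u))
  middle-in : suc k ≤ count R → ⊥
  middle-in many with h , h-inj , h∈R ← select R (suc k) many =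
    distinguished-bound modular (λ u → C (a (h u)) (c (h u))) (λ u → B (c (h u)))
      h∈R (λ u → not-injective (c∉S (h u)))
      (λ u v u≢v → xor-differs b refl (λ eq → u≢v (h-inj (c-inj eq))))
  middle-out : suc k ≤ count (not ∘ R) → ⊥
  middle-out many with h , h-inj , h∉R ← select (not ∘ R) (suc k) many =
    distinguished-bound modular (λ u → A (a (h u))) (λ u → C (a (h u)) (c (h u)))
      (λ u → a∈S (h u)) (λ u → not-injective (h∉R u))
      (λ u v u≢v → xor-differs b refl (λ eq → u≢v (h-inj (a-inj (sym eq)))))

swap : ∀ {m} → Vtx m → Vtx m
swap (A i)   = B i
swap (B j)   = A j
swap (C i j) = C j i

adjV-swap : ∀ {m} b (u w : Vtx m) → adjV b (swap u) (swap w) ≡ adjV b u w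
adjV-swap b (A _)   (A _)   = refl
adjV-swap b (A _)   (B _)   = refl
adjV-swap b (A _)   (C _ _) = refl
adjV-swap b (B _)   (A _)   = refl
adjV-swap b (B _)   (B _)   = refl
adjV-swap b (B _)   (C _ _) = refl
adjV-swap b (C _ _) (A _)   = refl
adjV-swap b (C _ _) (B _)   = refl
adjV-swap b (C _ _) (C _ _) = refl

no-balanced-modular-set : ∀ k b {m} → m ≡ M k → (S : Vtx m → Bool) (lab : Vtx m → Fin k) →
  ModularBy (adjV b) S lab → ¬ Between (L k + L k) (count (S ∘ A) + count (S ∘ B))
no-balanced-modular-set k b m≡M S lab modular balanced
  with side-split (L k) _ _ _ _ (trans (count-complement (S ∘ A)) m≡M)
                                (trans (count-complement (S ∘ B)) m≡M) balanced
... | inj₁ (A-in , B-out) = A-in-B-out-impossible k b modular A-in B-out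
... | inj₂ (B-in , A-out) = A-in-B-out-impossible k b swapped B-in A-out
  where
  swapped : ModularBy (adjV b) (S ∘ swap) (lab ∘ swap)
  swapped = modular-pullback swap (λ u w → sym (adjV-swap b u w)) modular

count-all-sides : ∀ m → count (isSide ∘ decode m) ≡ m + m
count-all-sides m = begin
  count (isSide ∘ decode m)                       ≡⟨ count-∩-true (isSide ∘ decode m) ⟨
  count ((isSide ∘ decode m) ∩ (λ _ → true))      ≡⟨ count-sides m (λ _ → true) ⟩
  count {m} (λ _ → true) + count {m} (λ _ → true) ≡⟨ cong₂ _+_ (count-true m) (count-true m) ⟩
  m + m                                           ∎
  where open ≡-Reasoning

2L≤m+m : ∀ k {m} → m ≡ M k → L k + L k ≤ m + m
2L≤m+m k refl = ≤-trans (m≤m+n (L k + L k) (L k)) (m≤m+n (M k) (M k))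

family-cw-large : ∀ k b m → m ≡ M k → ¬ CWAtMost k (family b m)
family-cw-large k b m m≡M cw
  with S , lab , modular , balanced ← balanced-cut (family b m) cw (isSide ∘ decode m)
                                        (L k + L k) (s≤s z≤n)
                                        (subst (L k + L k ≤_) (sym (count-all-sides m)) (2L≤m+m k m≡M))
  = no-balanced-modular-set k b m≡M (S ∘ encode m) (lab ∘ encode m)
      (modular-pullback (encode m) adj-encode modular)
      (between-≡ (sym (count-sides m S)) balanced)
  where
  adj-encode : ∀ u w → adjV b u w ≡ adjV b (decode m (encode m u)) (decode m (encode m w))
  adj-encode u w = sym (cong₂ (adjV b) (decode-encode m u) (decode-encode m w))

coloured : Bool → ℕ → Bool → LBGraph
coloured b m β = record
  { graph  = family b m
  ; col    = colV β ∘ decode m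
  ; proper = λ x y → colV-proper b β (decode m x) (decode m y) }

module Embedded (H : LBGraph) (b : Bool) (m : ℕ) (β : Bool) (emb : H ⊆li coloured b m β) where
  ψ : Fin (n (graph H)) → Vtx m
  ψ = decode m ∘ proj₁ emb

  ψ-distinct : ∀ {x y} → x ≢ y → ψ x ≢ ψ y
  ψ-distinct x≢y eq = x≢y (proj₁ (proj₂ emb) (decode-injective m eq))

  ψ-adj : ∀ x y → adjV b (ψ x) (ψ y) ≡ adj (graph H) x y
  ψ-adj = proj₁ (proj₂ (proj₂ emb))

  ψ-col : ∀ x → colV β (ψ x) ≡ col H x
  ψ-col = proj₂ (proj₂ (proj₂ emb))

middle-of-colour : ∀ {m} β (u : Vtx m) → colV β u ≡ β → Σ (Fin m) λ i → Σ (Fin m) λ j → u ≡ C i j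
middle-of-colour β (A _)   eq = ⊥-elim (not-¬ refl (sym eq))
middle-of-colour β (B _)   eq = ⊥-elim (not-¬ refl (sym eq))
middle-of-colour β (C i j) eq = i , j , refl

side-of-colour : ∀ {m} β (u : Vtx m) → colV β u ≡ not β → isSide u ≡ true
side-of-colour β (A _)   eq = refl
side-of-colour β (B _)   eq = refl
side-of-colour β (C _ _) eq = ⊥-elim (not-¬ refl eq)

End : ∀ {m} → Fin m → Fin m → Vtx m → Set
End i j u = u ≡ A i ⊎ u ≡ B j

no-three-ends : ∀ {m} {i j : Fin m} {x y z : Vtx m} → x ≢ y → x ≢ z → y ≢ z →
  End i j x → End i j y → End i j z → ⊥
no-three-ends x≢y x≢z y≢z (inj₁ refl) (inj₁ refl) _           = x≢y refl
no-three-ends x≢y x≢z y≢z (inj₂ refl) (inj₂ refl) _           = x≢y refl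
no-three-ends x≢y x≢z y≢z (inj₁ refl) (inj₂ refl) (inj₁ refl) = x≢z refl
no-three-ends x≢y x≢z y≢z (inj₁ refl) (inj₂ refl) (inj₂ refl) = y≢z refl
no-three-ends x≢y x≢z y≢z (inj₂ refl) (inj₁ refl) (inj₁ refl) = y≢z refl
no-three-ends x≢y x≢z y≢z (inj₂ refl) (inj₁ refl) (inj₂ refl) = x≢z refl

common-ends : ∀ {m} {i j i′ j′ : Fin m} {x y : Vtx m} → x ≢ y →
  End i j x → End i′ j′ x → End i j y → End i′ j′ y → _≡_ {A = Vtx m} (C i j) (C i′ j′)
common-ends x≢y (inj₁ refl) (inj₁ refl) (inj₁ refl) _           = ⊥-elim (x≢y refl)
common-ends x≢y (inj₁ refl) (inj₁ refl) (inj₂ refl) (inj₂ refl) = refl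
common-ends x≢y (inj₂ refl) (inj₂ refl) (inj₂ refl) _           = ⊥-elim (x≢y refl)
common-ends x≢y (inj₂ refl) (inj₂ refl) (inj₁ refl) (inj₁ refl) = refl

≟-sound : ∀ {m} {i j : Fin m} → ⌊ i ≟ j ⌋ ≡ true → i ≡ j
≟-sound {i = i} {j} eq with i ≟ j
≟-sound _  | yes i≡j = i≡j
≟-sound () | no _

neighbour-is-end : ∀ {m} {i j : Fin m} u → adjV false (C i j) u ≡ true → End i j u
neighbour-is-end (A _) adjacent = inj₁ (cong A (≟-sound adjacent))
neighbour-is-end (B _) adjacent = inj₂ (cong B (≟-sound adjacent))

non-neighbour-is-end : ∀ {m} {i j : Fin m} u → adjV true (C i j) u ≡ false → isSide u ≡ true → End i j u
non-neighbour-is-end (A _) non-adjacent _ = inj₁ (cong A (≟-sound (not-injective non-adjacent)))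
non-neighbour-is-end (B _) non-adjacent _ = inj₂ (cong B (≟-sound (not-injective non-adjacent)))

weakly-free-by : ∀ H b m β → ¬ (H ⊆li coloured b m β) → WeaklyFree H (family b m)
weakly-free-by H b m β no-embedding = col (coloured b m β) , proper (coloured b m β) , no-embedding

-- Colour the middle vertices of the subdivision like a vertex
-- v of degree at least 3: then v must be placed on a middle vertex, but all
-- neighbours of a middle vertex are among its two ends.
weakly-free-of-degree-3 : ∀ H m → HasVertexDeg≥3 H → WeaklyFree H (family false m)
weakly-free-of-degree-3 H m (v , 3≤deg)
  with u , u-inj , u-nbr ← select (adj (graph H) v) 3 (subst (3 ≤_) (degree-count (graph H) v) 3≤deg)
  = weakly-free-by H false m (col H v) no-embedding
  where
  no-embedding : ¬ (H ⊆li coloured false m (col H v))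
  no-embedding emb = three-ends (middle-of-colour (col H v) (ψ v) (ψ-col v))
    where
    open Embedded H false m (col H v) emb
    u-distinct : ∀ {t t′} → t ≢ t′ → ψ (u t) ≢ ψ (u t′)
    u-distinct t≢t′ = ψ-distinct (t≢t′ ∘ u-inj)
    three-ends : (Σ (Fin m) λ i → Σ (Fin m) λ j → ψ v ≡ C i j) → ⊥
    three-ends (i , j , ψv≡Cij) =
      no-three-ends (u-distinct (λ ())) (u-distinct (λ ())) (u-distinct (λ ())) (end 0F) (end 1F) (end 2F)
      where
      end : ∀ t → End i j (ψ (u t))
      end t = neighbour-is-end (ψ (u t)) (begin
        adjV false (C i j) (ψ (u t)) ≡⟨ cong (λ x → adjV false x (ψ (u t))) ψv≡Cij ⟨
        adjV false (ψ v) (ψ (u t))   ≡⟨ ψ-adj v (u t) ⟩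
        adj (graph H) v (u t)        ≡⟨ u-nbr t ⟩
        true                         ∎)
        where open ≡-Reasoning

four-split : ∀ p q → p + q ≡ 4 → 1 ≤ p → 1 ≤ q →
  (1 ≤ p × 3 ≤ q) ⊎ (2 ≤ p × 2 ≤ q) ⊎ (3 ≤ p × 1 ≤ q)
four-split 0 _ _    () _
four-split 1 _ refl _  _  = inj₁ (≤-refl , ≤-refl)
four-split 2 _ refl _  _  = inj₂ (inj₁ (≤-refl , ≤-refl))
four-split 3 _ refl _  _  = inj₂ (inj₂ (≤-refl , ≤-refl))
four-split 4 _ refl _  ()
four-split (suc (suc (suc (suc (suc _))))) _ () _ _

-- In the graph with b = true a middle vertex C i j is non-adjacent to exactly
-- two side vertices, its ends, and two middle vertices share at most one end.
-- Hence no independent set of four vertices has one middle and three side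
-- vertices, or two of each: colouring the middle vertices with the rarer
-- colour among w rules out every embedding.
module MixedFour (H : LBGraph) (m : ℕ) (w : Fin 4 → Fin (n (graph H)))
  (w-inj : Injective _≡_ _≡_ w) (w-indep : ∀ i j → i ≢ j → adj (graph H) (w i) (w j) ≡ false) where

  ofColour : Bool → Fin 4 → Bool
  ofColour true  x = col H (w x)
  ofColour false x = not (col H (w x))

  select-colour : ∀ γ r → r ≤ count (ofColour γ) →
    Σ (Fin r → Fin 4) λ g → Injective _≡_ _≡_ g × (∀ t → col H (w (g t)) ≡ γ)
  select-colour true  r many = select (ofColour true) r many
  select-colour false r many with g , g-inj , g-col ← select (ofColour false) r many =
    g , g-inj , not-injective ∘ g-col

  module _ {β : Bool} (emb : H ⊆li coloured true m β) where
    open Embedded H true m β emb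

    z : Fin 4 → Vtx m
    z = ψ ∘ w

    z-distinct : ∀ {x y} → x ≢ y → z x ≢ z y
    z-distinct x≢y = ψ-distinct (x≢y ∘ w-inj)

    ends-of : ∀ s → col H (w s) ≡ β → Σ (Fin m) λ i → Σ (Fin m) λ j → z s ≡ C i j ×
      (∀ x → col H (w x) ≡ not β → End i j (z x))
    ends-of s s-col with i , j , zs≡Cij ← middle-of-colour β (z s) (trans (ψ-col (w s)) s-col) =
      i , j , zs≡Cij , λ x x-col →
        non-neighbour-is-end (z x) (non-adjacent x x-col) (side-of-colour β (z x) (trans (ψ-col (w x)) x-col))
      where
      non-adjacent : ∀ x → col H (w x) ≡ not β → adjV true (C i j) (z x) ≡ false
      non-adjacent x x-col = begin
        adjV true (C i j) (z x)   ≡⟨ cong (λ y → adjV true y (z x)) zs≡Cij ⟨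
        adjV true (z s) (z x)     ≡⟨ ψ-adj (w s) (w x) ⟩
        adj (graph H) (w s) (w x) ≡⟨ w-indep s x (λ { refl → not-¬ s-col x-col }) ⟩
        false                     ∎
        where open ≡-Reasoning

    -- One vertex of the middle colour and three of the other: the three
    -- would be distinct ends of the same middle vertex.
    one-three : 1 ≤ count (ofColour β) → 3 ≤ count (ofColour (not β)) → ⊥
    one-three one three
      with s , _ , s-col ← select-colour β 1 one
         | x , x-inj , x-col ← select-colour (not β) 3 three
      with i , j , _ , ends ← ends-of (s 0F) (s-col 0F)
      = no-three-ends (distinct (λ ())) (distinct (λ ())) (distinct (λ ())) (end 0F) (end 1F) (end 2F)
      where
      distinct : ∀ {t t′} → t ≢ t′ → z (x t) ≢ z (x t′)
      distinct t≢t′ = z-distinct (t≢t′ ∘ x-inj)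
      end : ∀ t → End i j (z (x t))
      end t = ends (x t) (x-col t)

    -- Two of each colour: the two middle vertices would share two ends.
    two-two : 2 ≤ count (ofColour β) → 2 ≤ count (ofColour (not β)) → ⊥
    two-two two two′
      with s , s-inj , s-col ← select-colour β 2 two
         | x , x-inj , x-col ← select-colour (not β) 2 two′
      with i , j , zs₀≡Cij , ends₀ ← ends-of (s 0F) (s-col 0F)
         | i′ , j′ , zs₁≡Ci′j′ , ends₁ ← ends-of (s 1F) (s-col 1F)
      = z-distinct ((λ ()) ∘ s-inj {0F} {1F}) (begin
          z (s 0F)  ≡⟨ zs₀≡Cij ⟩
          C i j     ≡⟨ common-ends (z-distinct ((λ ()) ∘ x-inj {0F} {1F}))
                         (ends₀ (x 0F) (x-col 0F)) (ends₁ (x 0F) (x-col 0F))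
                         (ends₀ (x 1F) (x-col 1F)) (ends₁ (x 1F) (x-col 1F)) ⟩
          C i′ j′   ≡⟨ zs₁≡Ci′j′ ⟨
          z (s 1F)  ∎)
      where open ≡-Reasoning

-- Choose the middle colour β so that the classes of the four vertices have
-- sizes (1 , 3) or (2 , 2) for (β , not β).
weakly-free-of-mixed-4 : ∀ H m → HasMixedIndep4 H → WeaklyFree H (family true m)
weakly-free-of-mixed-4 H m (w , w-inj , w-indep , i₀ , j₀ , mixed)
  with has-black , has-white ← both-values (col H ∘ w) i₀ j₀ mixed
  = by-class-sizes (four-split _ _ (count-complement (col H ∘ w)) has-black has-white)
  where
  open MixedFour H m w w-inj w-indep
  by-class-sizes : (1 ≤ count (ofColour true) × 3 ≤ count (ofColour false))
                 ⊎ (2 ≤ count (ofColour true) × 2 ≤ count (ofColour false))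
                 ⊎ (3 ≤ count (ofColour true) × 1 ≤ count (ofColour false)) →
                 WeaklyFree H (family true m)
  by-class-sizes (inj₁ (one , three))        = weakly-free-by H true m true (λ emb → one-three emb one three)
  by-class-sizes (inj₂ (inj₁ (two , two′)))  = weakly-free-by H true m true (λ emb → two-two emb two two′)
  by-class-sizes (inj₂ (inj₂ (three , one))) = weakly-free-by H true m false (λ emb → one-three emb one three)

weakly-free-family : ∀ H → HasVertexDeg≥3 H ⊎ HasMixedIndep4 H →
  Σ Bool λ b → ∀ m → WeaklyFree H (family b m)
weakly-free-family H (inj₁ deg3)  = false , λ m → weakly-free-of-degree-3 H m deg3
weakly-free-family H (inj₂ mixed) = true  , λ m → weakly-free-of-mixed-4 H m mixed

weakly-free-bipartite : ∀ H G → WeaklyFree H G → Bipartite G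
weakly-free-bipartite H G (c , proper-c , _) = c , proper-c

lemma10 : (H : LBGraph) → HasVertexDeg≥3 H ⊎ HasMixedIndep4 H → UnboundedCW (WeaklyFreeBipartite H)
lemma10 H condition (k , bounded) with b , free ← weakly-free-family H condition =
  family-cw-large k b (M k) refl
    (bounded (family b (M k)) (weakly-free-bipartite H (family b (M k)) (free (M k)) , free (M k)))
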